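{- For every $\varepsilon>0$, every $\rho_0>0$ and every $N_0\in\mathbb{N}$ there exist $\rho\in(0,\rho_0)$ and a connected graph $G$ of girth at least $5$ on $n>N_0$ vertices such that $h_{\rho}(G)>(1-\varepsilon)\rho n$.
   Context: All graphs are finite and simple; the girth of a graph is the length of its shortest cycle (infinite if it has no cycle). For a graph $G$, a constant $\rho\in[0,1]$ and a set $A\subseteq V(G)$, define the infecting sequence by $A_0:=A$ and $A_{i+1}:=A_i\cup\{v\in V(G): |N_G(v)\cap A_i|\geq \rho\, d_G(v)\}$, where $N_G(v)$ is the neighbourhood and $d_G(v)$ the degree of $v$. Since $G$ is finite the sequence stabilises; the final set is denoted $H_{\rho,G}(A)$. A set $A$ is a contagious set for $G$ (with respect to $\rho$) if $H_{\rho,G}(A)=V(G)$. $h_{\rho}(G)$ denotes the minimum size of a contagious set for $G$ with respect to $\rho$.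
   Formalization: The parameters ε and ρ₀ range over the positive rationals, and the constant ρ is taken in the rationals. -}

module Defs where

open import Data.Nat using (ℕ; zero; suc)
open import Data.Bool using (Bool; true; false; T; _∨_)
open import Data.Fin using (Fin)
open import Data.Fin.Subset using (Subset; _∈_; _∩_; ∣_∣)
open import Data.Vec using (tabulate; lookup)
open import Data.Integer using (+_)
open import Data.Rational using (ℚ; _/_; _*_; _≤_)
open import Data.Rational.Properties using (_≤?_)
open import Data.Product using (Σ; ∃; _×_; _,_)
open import Relation.Binary.PropositionalEquality using (_≡_; _≢_)
open import Relation.Nullary using (¬_; does)

record Graph (n : ℕ) : Set where
  field
    adj  : Fin n → Fin n → Bool
    sym  : ∀ u v → adj u v ≡ adj v u
    irr  : ∀ v → adj v v ≡ false

open Graph public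

_~[_]_ : ∀ {n} → Fin n → Graph n → Fin n → Set
u ~[ G ] v = T (adj G u v)

N : ∀ {n} → Graph n → Fin n → Subset n
N G v = tabulate (adj G v)

deg : ∀ {n} → Graph n → Fin n → ℕ
deg G v = ∣ N G v ∣

ℕ→ℚ : ℕ → ℚ
ℕ→ℚ k = + k / 1

infSeq : ∀ {n} → Graph n → ℚ → Subset n → ℕ → Subset n
infSeq G ρ A zero    = A
infSeq G ρ A (suc i) =
  tabulate (λ v → lookup (infSeq G ρ A i) v
                 ∨ does (ρ * ℕ→ℚ (deg G v) ≤? ℕ→ℚ ∣ N G v ∩ infSeq G ρ A i ∣))

-- A is contagious: the (monotone) sequence eventually equals V(G),
-- i.e. the final set H_{ρ,G}(A) is all of V(G)
Contagious : ∀ {n} → Graph n → ℚ → Subset n → Set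
Contagious G ρ A = ∃ λ i → ∀ v → v ∈ infSeq G ρ A i

data Reach {n : ℕ} (G : Graph n) : Fin n → Fin n → Set where
  here : ∀ {v} → Reach G v v
  step : ∀ {u v w} → u ~[ G ] v → Reach G v w → Reach G u w

Connected : ∀ {n} → Graph n → Set
Connected G = ∀ u v → Reach G u v

-- girth ≥ 5: no cycle of length 3 or 4 (simple graphs have no shorter cycles)
NoTriangle : ∀ {n} → Graph n → Set
NoTriangle G = ∀ a b c → ¬ (a ~[ G ] b × b ~[ G ] c × c ~[ G ] a)

NoC4 : ∀ {n} → Graph n → Set
NoC4 G = ∀ a b c d → a ≢ c → b ≢ d →
  ¬ (a ~[ G ] b × b ~[ G ] c × c ~[ G ] d × d ~[ G ] a)

GirthAtLeast5 : ∀ {n} → Graph n → Set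
GirthAtLeast5 G = NoTriangle G × NoC4 G

{-# OPTIONS --safe #-}
module Submission where

-- Take for G the rooted tree of depth two whose root has k children (hubs), each hub having
-- e + 1 children (leaves), and take ρ = 1/(e+1).  A hub has degree e + 2 but only one
-- neighbour, the root, outside its star, and a leaf has none; so every vertex of a star has
-- fewer than ρ·d(v) neighbours outside it, and a star without infected vertices never gets
-- one.  Hence a contagious set meets all k stars, while n = 1 + k(e+2) gives (1 - ε)ρn < k
-- once k and e are large compared with the denominator of ε (and e with that of ρ₀).
-- Being a tree, G is connected and has no cycles at all.

open import Data.Bool using (Bool; false; T)
open import Data.Bool.Properties using (T-≡; T-∨)
open import Data.Empty using (⊥; ⊥-elim)
open import Data.Fin using (Fin; zero; suc)
import Data.Fin as Fin
import Data.Fin.Induction as Fin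
import Data.Fin.Properties as Fin
open import Data.Fin.Subset using (Subset; _∈_; _∉_; _⊆_; _∩_; ∁; _─_; ⁅_⁆; ∣_∣; Empty; Nonempty)
open import Data.Fin.Subset.Properties
  using ( p⊆q⇒∣p∣≤∣q∣; x∈p⇒∣p-x∣<∣p∣; x∈p∧x≢y⇒x∈p-y; x∈p∩q⁺; x∈p∩q⁻; x∉p⇒x∈∁p; x∈∁p⇒x∉p
        ; x∈⁅y⁆⇔x≡y; ∣⁅x⁆∣≡1; ∣⊥∣≡0; Empty-unique; nonempty? )
open import Data.Integer as ℤ using (+_; -[1+_])
import Data.Integer.Properties as ℤ
open import Data.Nat using (ℕ; zero; suc; _>_; z≤n; s≤s)
import Data.Nat as ℕ
import Data.Nat.Properties as ℕ
open import Data.Nat.Coprimality using (1-coprimeTo) renaming (sym to coprime-sym)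
open import Data.Nat.Tactic.RingSolver using (solve-∀)
open import Data.Product using (Σ; ∃; _×_; _,_; proj₁; proj₂; uncurry)
open import Data.Rational using (ℚ; mkℚ; 0ℚ; 1ℚ; _<_; _≤_; _*_; _-_; toℚᵘ)
import Data.Rational as ℚ
import Data.Rational.Properties as ℚ
open import Data.Rational.Unnormalised as ℚᵘ using (mkℚᵘ; _/_)
  renaming (_*_ to _*ᵘ_; _-_ to _-ᵘ_; _<_ to _<ᵘ_; _≤_ to _≤ᵘ_; 1ℚᵘ to 1ᵘ)
import Data.Rational.Unnormalised.Properties as ℚᵘ
open import Data.Sum using (_⊎_; inj₁; inj₂)
import Data.Sum as Sum
open import Data.Vec using (tabulate)
open import Data.Vec.Properties using (lookup∘tabulate; []=⇒lookup; lookup⇒[]=)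
open import Function using (_∘_; mk⇔; Equivalence)
open import Function.Definitions using (Injective)
open import Induction.WellFounded using (Acc; acc)
open import Relation.Binary.PropositionalEquality using (_≡_; _≢_; refl; sym; trans; cong; subst; subst₂)
open import Relation.Nullary using (¬_; Dec; yes; no; does; contradiction)
open import Relation.Nullary.Decidable using (dec-false; does-⇔; _×-dec_; _⊎-dec_)

open import Defs renaming (sym to adj-sym)

injective⇒≤∣p∣ : ∀ {m n} {p : Subset n} (f : Fin m → Fin n) →
                 Injective _≡_ _≡_ f → (∀ i → f i ∈ p) → m ℕ.≤ ∣ p ∣
injective⇒≤∣p∣ {zero}          f f-inj f∈p = z≤n
injective⇒≤∣p∣ {suc m} {p = p} f f-inj f∈p =
  ℕ.≤-trans (s≤s (injective⇒≤∣p∣ (f ∘ suc) (Fin.suc-injective ∘ f-inj) f∘suc∈p-f0))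
            (x∈p⇒∣p-x∣<∣p∣ (f∈p zero))
  where
  f∘suc∈p-f0 : ∀ i → f (suc i) ∈ p ─ ⁅ f zero ⁆
  f∘suc∈p-f0 i = x∈p∧x≢y⇒x∈p-y (f∈p (suc i)) (λ eq → Fin.0≢1+n (sym (f-inj eq)))

disjoint-meets⇒≤∣p∣ : ∀ {k n} {p : Subset n} (B : Fin k → Subset n) →
                      (∀ {i j} x → x ∈ B i → x ∈ B j → i ≡ j) → (∀ j → Nonempty (p ∩ B j)) → k ℕ.≤ ∣ p ∣
disjoint-meets⇒≤∣p∣ {k} {n} {p} B disjoint meets = injective⇒≤∣p∣ w w-injective (proj₁ ∘ w∈p∩B)
  where
  w : Fin k → Fin n
  w j = proj₁ (meets j)
  w∈p∩B : ∀ j → w j ∈ p × w j ∈ B j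
  w∈p∩B j = x∈p∩q⁻ p (B j) (proj₂ (meets j))
  w-injective : Injective _≡_ _≡_ w
  w-injective {i} {j} wi≡wj = disjoint (w j) (subst (_∈ B i) wi≡wj (proj₂ (w∈p∩B i))) (proj₂ (w∈p∩B j))

module _ {n} {f : Fin n → Bool} {x : Fin n} where

  ∈-tabulate⁻ : x ∈ tabulate f → T (f x)
  ∈-tabulate⁻ x∈ = Equivalence.from T-≡ (trans (sym (lookup∘tabulate f x)) ([]=⇒lookup x∈))

  ∈-tabulate⁺ : T (f x) → x ∈ tabulate f
  ∈-tabulate⁺ t = lookup⇒[]= x (tabulate f) (trans (lookup∘tabulate f x) (Equivalence.to T-≡ t))

module _ {a} {A : Set a} where

  T-does⁻ : (a? : Dec A) → T (does a?) → A
  T-does⁻ (yes a) _ = a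

  T-does⁺ : (a? : Dec A) → A → T (does a?)
  T-does⁺ (yes _) _ = _
  T-does⁺ (no ¬a) a = ¬a a

1/[1+_] : ℕ → ℚ
1/[1+ e ] = mkℚ (+ 1) e (1-coprimeTo _)

-- Inequalities between rationals are proved in ℚᵘ, where products are not normalised and
-- + a / suc b < + c / suc d unfolds to a * suc d < c * suc b.
toℚᵘ-ℕ→ℚ : ∀ k → toℚᵘ (ℕ→ℚ k) ≡ + k / 1
toℚᵘ-ℕ→ℚ k = cong toℚᵘ (ℚ.normalize-coprime (coprime-sym (1-coprimeTo k)))

/-*-/ : ∀ a b c d → (+ a / suc b) *ᵘ (+ c / suc d) ≡ + (a ℕ.* c) / (suc b ℕ.* suc d)
/-*-/ a b c d = cong (λ z → mkℚᵘ z (d ℕ.+ b ℕ.* suc d)) (sym (ℤ.pos-* a c))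

/-<-cross : ∀ {a b c d} → a ℕ.* suc d ℕ.< c ℕ.* suc b → + a / suc b <ᵘ + c / suc d
/-<-cross {a} {b} {c} {d} h = ℚᵘ.*<* (subst₂ ℤ._<_ (ℤ.pos-* a (suc d)) (ℤ.pos-* c (suc b)) (ℤ.+<+ h))

/-≤-cross : ∀ {a b c d} → a ℕ.* suc d ℕ.≤ c ℕ.* suc b → + a / suc b ≤ᵘ + c / suc d
/-≤-cross {a} {b} {c} {d} h = ℚᵘ.*≤* (subst₂ ℤ._≤_ (ℤ.pos-* a (suc d)) (ℤ.pos-* c (suc b)) (ℤ.+≤+ h))

ℕ→ℚ-mono-≤ : ∀ {m n} → m ℕ.≤ n → ℕ→ℚ m ≤ ℕ→ℚ n
ℕ→ℚ-mono-≤ {m} {n} m≤n = ℚ.toℚᵘ-cancel-≤ (subst₂ _≤ᵘ_ (sym (toℚᵘ-ℕ→ℚ m)) (sym (toℚᵘ-ℕ→ℚ n))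
  (/-≤-cross (ℕ.*-monoˡ-≤ 1 m≤n)))

ℕ→ℚ<1/[1+e]*ℕ→ℚ : ∀ e {c d} → c ℕ.* suc e ℕ.< d → ℕ→ℚ c < 1/[1+ e ] * ℕ→ℚ d
ℕ→ℚ<1/[1+e]*ℕ→ℚ e {c} {d} h = ℚ.toℚᵘ-cancel-< (begin-strict
  toℚᵘ (ℕ→ℚ c)                               ≡⟨ toℚᵘ-ℕ→ℚ c ⟩
  + c / 1                                     <⟨ /-<-cross cross ⟩
  + (1 ℕ.* d) / (suc e ℕ.* 1)                 ≡⟨ /-*-/ 1 e d 0 ⟨
  toℚᵘ 1/[1+ e ] *ᵘ (+ d / 1)                 ≡⟨ cong (toℚᵘ 1/[1+ e ] *ᵘ_) (toℚᵘ-ℕ→ℚ d) ⟨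
  toℚᵘ 1/[1+ e ] *ᵘ toℚᵘ (ℕ→ℚ d)              ≃⟨ ℚ.toℚᵘ-homo-* 1/[1+ e ] (ℕ→ℚ d) ⟨
  toℚᵘ (1/[1+ e ] * ℕ→ℚ d)                    ∎)
  where
  open ℚᵘ.≤-Reasoning
  cross : c ℕ.* (suc e ℕ.* 1) ℕ.< 1 ℕ.* d ℕ.* 1
  cross = subst₂ ℕ._<_ (cong (c ℕ.*_) (sym (ℕ.*-identityʳ (suc e))))
                       (sym (trans (ℕ.*-identityʳ (1 ℕ.* d)) (ℕ.*-identityˡ d))) h

module _ {n} (G : Graph n) where

  Reach-trans : ∀ {u v w} → Reach G u v → Reach G v w → Reach G u w
  Reach-trans here       q = q
  Reach-trans (step e p) q = step e (Reach-trans p q)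

  Reach-sym : ∀ {u v} → Reach G u v → Reach G v u
  Reach-sym here       = here
  Reach-sym (step {u} {v} e p) = Reach-trans (Reach-sym p) (step (subst T (adj-sym G u v) e) here)

module _ {n} (G : Graph n) (ρ : ℚ) where

  Resistant : Subset n → Set
  Resistant B = ∀ v → v ∈ B → ℕ→ℚ ∣ N G v ∩ ∁ B ∣ < ρ * ℕ→ℚ (deg G v)

  ∈-infSeq-suc⁻ : ∀ A i {v} → v ∈ infSeq G ρ A (suc i) →
    v ∈ infSeq G ρ A i ⊎ ρ * ℕ→ℚ (deg G v) ≤ ℕ→ℚ ∣ N G v ∩ infSeq G ρ A i ∣
  ∈-infSeq-suc⁻ A i {v} =
    Sum.map (lookup⇒[]= v _ ∘ Equivalence.to T-≡) (T-does⁻ (_ ℚ.≤? _)) ∘ Equivalence.to T-∨ ∘ ∈-tabulate⁻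

  resistant-uninfected : ∀ {A B i v} → Resistant B → Empty (infSeq G ρ A i ∩ B) →
                         v ∈ B → v ∉ infSeq G ρ A (suc i)
  resistant-uninfected {A} {B} {i} {v} res Aᵢ∩B=∅ v∈B v∈Aᵢ₊₁ =
    Sum.[ (λ v∈Aᵢ → Aᵢ∩B=∅ (v , x∈p∩q⁺ (v∈Aᵢ , v∈B)))
        , (λ infected → ℚ.<-irrefl refl (ℚ.≤-<-trans infected (ℚ.≤-<-trans few (res v v∈B))))
        ] (∈-infSeq-suc⁻ A i v∈Aᵢ₊₁)
    where
    N∩Aᵢ⊆N∩∁B : N G v ∩ infSeq G ρ A i ⊆ N G v ∩ ∁ B
    N∩Aᵢ⊆N∩∁B {x} x∈ =
      let x∈N , x∈Aᵢ = x∈p∩q⁻ (N G v) (infSeq G ρ A i) x∈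
      in  x∈p∩q⁺ (x∈N , x∉p⇒x∈∁p (λ x∈B → Aᵢ∩B=∅ (x , x∈p∩q⁺ (x∈Aᵢ , x∈B))))
    few : ℕ→ℚ ∣ N G v ∩ infSeq G ρ A i ∣ ≤ ℕ→ℚ ∣ N G v ∩ ∁ B ∣
    few = ℕ→ℚ-mono-≤ (p⊆q⇒∣p∣≤∣q∣ N∩Aᵢ⊆N∩∁B)

  infSeq-avoids-resistant : ∀ {A B} → Resistant B → Empty (A ∩ B) → ∀ i → Empty (infSeq G ρ A i ∩ B)
  infSeq-avoids-resistant res A∩B=∅ zero = A∩B=∅
  infSeq-avoids-resistant {A} {B} res A∩B=∅ (suc i) (v , v∈Aᵢ₊₁∩B) =
    let v∈Aᵢ₊₁ , v∈B = x∈p∩q⁻ (infSeq G ρ A (suc i)) B v∈Aᵢ₊₁∩B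
    in  resistant-uninfected {A} {B} {i} res (infSeq-avoids-resistant res A∩B=∅ i) v∈B v∈Aᵢ₊₁

  contagious⇒meets-resistant : ∀ {A B v} → Contagious G ρ A → Resistant B → v ∈ B → Nonempty (A ∩ B)
  contagious⇒meets-resistant {A} {B} {v} (i , all∈) res v∈B with nonempty? (A ∩ B)
  ... | yes A∩B≠∅ = A∩B≠∅
  ... | no  A∩B=∅ = contradiction (v , x∈p∩q⁺ (all∈ v , v∈B)) (infSeq-avoids-resistant res A∩B=∅ i)

module ParentGraph {n} (parent : Fin n → Fin n) where

  ChildOf : Fin n → Fin n → Set
  ChildOf u v = v Fin.< u × parent u ≡ v

  Linked : Fin n → Fin n → Set
  Linked u v = ChildOf u v ⊎ ChildOf v u

  childOf? : ∀ u v → Dec (ChildOf u v)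
  childOf? u v = v Fin.<? u ×-dec parent u Fin.≟ v

  linked? : ∀ u v → Dec (Linked u v)
  linked? u v = childOf? u v ⊎-dec childOf? v u

  Linked-irrefl : ∀ {v} → ¬ Linked v v
  Linked-irrefl (inj₁ (v<v , _)) = Fin.<-irrefl refl v<v
  Linked-irrefl (inj₂ (v<v , _)) = Fin.<-irrefl refl v<v

  graph : Graph n
  graph = record
    { adj = λ u v → does (linked? u v)
    ; sym = λ u v → does-⇔ (mk⇔ Sum.swap Sum.swap) (linked? u v) (linked? v u)
    ; irr = λ v → dec-false (linked? v v) Linked-irrefl
    }

  ~⇒Linked : ∀ u v → u ~[ graph ] v → Linked u v
  ~⇒Linked u v = T-does⁻ (linked? u v)

  Linked⇒~ : ∀ u v → Linked u v → u ~[ graph ] v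
  Linked⇒~ u v = T-does⁺ (linked? u v)

  ∈N⇒Linked : ∀ {u v} → u ∈ N graph v → Linked v u
  ∈N⇒Linked = T-does⁻ (linked? _ _) ∘ ∈-tabulate⁻

  Linked⇒∈N : ∀ {u v} → Linked v u → u ∈ N graph v
  Linked⇒∈N = ∈-tabulate⁺ ∘ T-does⁺ (linked? _ _)

  parent-unique : ∀ {u v w} → ChildOf u v → ChildOf u w → v ≡ w
  parent-unique (_ , refl) (_ , refl) = refl

  -- Every edge joins a vertex to its parent, which has a smaller index.  So in a short cycle
  -- either some vertex has both of its cycle-neighbours as parent, or the indices decrease
  -- all the way round.
  no-triangle : ∀ {a b c} → Linked a b → Linked b c → Linked c a → ⊥
  no-triangle (inj₁ ab) bc        (inj₂ ac) = Linked-irrefl (subst (λ x → Linked x _) (parent-unique ab ac) bc)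
  no-triangle (inj₂ ba) (inj₁ bc) ca        = Linked-irrefl (subst (Linked _) (parent-unique ba bc) ca)
  no-triangle ab        (inj₂ cb) (inj₁ ca) = Linked-irrefl (subst (Linked _) (parent-unique cb ca) ab)
  no-triangle (inj₁ (b<a , _)) (inj₁ (c<b , _)) (inj₁ (a<c , _)) =
    Fin.<-irrefl refl (Fin.<-trans a<c (Fin.<-trans c<b b<a))
  no-triangle (inj₂ (a<b , _)) (inj₂ (b<c , _)) (inj₂ (c<a , _)) =
    Fin.<-irrefl refl (Fin.<-trans a<b (Fin.<-trans b<c c<a))

  no-square : ∀ {a b c d} → a ≢ c → b ≢ d → Linked a b → Linked b c → Linked c d → Linked d a → ⊥
  no-square a≢c b≢d (inj₁ ab) _         _         (inj₂ ad) = b≢d (parent-unique ab ad)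
  no-square a≢c b≢d (inj₂ ba) (inj₁ bc) _         _         = a≢c (parent-unique ba bc)
  no-square a≢c b≢d _         (inj₂ cb) (inj₁ cd) _         = b≢d (parent-unique cb cd)
  no-square a≢c b≢d _         _         (inj₂ dc) (inj₁ da) = a≢c (sym (parent-unique dc da))
  no-square _ _ (inj₁ (b<a , _)) (inj₁ (c<b , _)) (inj₁ (d<c , _)) (inj₁ (a<d , _)) =
    Fin.<-irrefl refl (Fin.<-trans a<d (Fin.<-trans d<c (Fin.<-trans c<b b<a)))
  no-square _ _ (inj₂ (a<b , _)) (inj₂ (b<c , _)) (inj₂ (c<d , _)) (inj₂ (d<a , _)) =
    Fin.<-irrefl refl (Fin.<-trans a<b (Fin.<-trans b<c (Fin.<-trans c<d d<a)))

  girth≥5 : GirthAtLeast5 graph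
  girth≥5 = (λ a b c (ab , bc , ca) → no-triangle (~⇒Linked a b ab) (~⇒Linked b c bc) (~⇒Linked c a ca))
          , (λ a b c d a≢c b≢d (ab , bc , cd , da) →
               no-square a≢c b≢d (~⇒Linked a b ab) (~⇒Linked b c bc) (~⇒Linked c d cd) (~⇒Linked d a da))

  connected : ∀ root → (∀ v → v ≢ root → parent v Fin.< v) → Connected graph
  connected root descends u v = Reach-trans graph (to-root u) (Reach-sym graph (to-root v))
    where
    to-root′ : ∀ v → Acc Fin._<_ v → Reach graph v root
    to-root′ v (acc smaller) with v Fin.≟ root
    ... | yes refl     = here
    ... | no  v≢root   =
      step (Linked⇒~ v (parent v) (inj₁ (descends v v≢root , refl)))
           (to-root′ (parent v) (smaller (descends v v≢root)))
    to-root : ∀ v → Reach graph v root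
    to-root v = to-root′ v (Fin.<-wellFounded v)

-- Vertex 0 is the root; vertex 1 + (l + 1)j + r is the hub of star j when r = 0 and one of
-- the l leaves of that hub otherwise.
module DepthTwoTree (k l : ℕ) where

  V : Set
  V = Fin (suc (k ℕ.* suc l))

  root : V
  root = zero

  vertex : Fin k → Fin (suc l) → V
  vertex j r = suc (Fin.combine j r)

  hub : Fin k → V
  hub j = vertex j zero

  parentOfVertex : Fin k → Fin (suc l) → V
  parentOfVertex j zero    = root
  parentOfVertex j (suc _) = hub j

  parent : V → V
  parent zero    = root
  parent (suc x) = uncurry parentOfVertex (Fin.remQuot (suc l) x)

  open ParentGraph parent public

  data View : V → Set where
    is-root   : View root
    is-vertex : ∀ j r → View (vertex j r)

  view : ∀ v → View v
  view zero    = is-root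
  view (suc x) = subst (View ∘ suc) (Fin.combine-remQuot {k} (suc l) x) (is-vertex _ _)

  parent-vertex : ∀ j r → parent (vertex j r) ≡ parentOfVertex j r
  parent-vertex j r = cong (uncurry parentOfVertex) (Fin.remQuot-combine j r)

  parentOfVertex<vertex : ∀ j r → parentOfVertex j r Fin.< vertex j r
  parentOfVertex<vertex j zero    = s≤s z≤n
  parentOfVertex<vertex j (suc r) =
    s≤s (subst₂ ℕ._<_ (sym (Fin.toℕ-combine j zero)) (sym (Fin.toℕ-combine j (suc r)))
                      (ℕ.+-monoʳ-< (suc l ℕ.* Fin.toℕ j) (s≤s z≤n)))

  vertex-childOf-parent : ∀ j r → ChildOf (vertex j r) (parentOfVertex j r)
  vertex-childOf-parent j r = parentOfVertex<vertex j r , parent-vertex j r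

  descends : ∀ v → v ≢ root → parent v Fin.< v
  descends v v≢root with view v
  ... | is-root       = contradiction refl v≢root
  ... | is-vertex j r = subst (Fin._< vertex j r) (sym (parent-vertex j r)) (parentOfVertex<vertex j r)

  quotient : Fin (k ℕ.* suc l) → Fin k
  quotient = Fin.quotient (suc l)

  inStar : Fin k → V → Bool
  inStar j zero    = false
  inStar j (suc x) = does (quotient x Fin.≟ j)

  star : Fin k → Subset (suc (k ℕ.* suc l))
  star j = tabulate (inStar j)

  ∈star⁻ : ∀ {j v} → v ∈ star j → T (inStar j v)
  ∈star⁻ {j} = ∈-tabulate⁻ {f = inStar j}

  vertex∈star : ∀ j r → vertex j r ∈ star j
  vertex∈star j r = ∈-tabulate⁺ {f = inStar j}
    (T-does⁺ (quotient (Fin.combine j r) Fin.≟ j) (cong proj₁ (Fin.remQuot-combine j r)))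

  ∈star-unique : ∀ {i j} v → v ∈ star i → v ∈ star j → i ≡ j
  ∈star-unique zero    v∈i _   = ⊥-elim (∈star⁻ v∈i)
  ∈star-unique (suc x) v∈i v∈j =
    trans (sym (T-does⁻ (quotient x Fin.≟ _) (∈star⁻ v∈i))) (T-does⁻ (quotient x Fin.≟ _) (∈star⁻ v∈j))

  ∈star⇒vertex : ∀ {j} v → v ∈ star j → ∃ λ r → v ≡ vertex j r
  ∈star⇒vertex v v∈ with view v
  ... | is-root       = ⊥-elim (∈star⁻ v∈)
  ... | is-vertex i r = r , cong (λ i → vertex i r) (∈star-unique _ (vertex∈star i r) v∈)

  parentOfVertex≡vertex⇒same-star : ∀ {i j} r′ r → parentOfVertex i r′ ≡ vertex j r → i ≡ j
  parentOfVertex≡vertex⇒same-star         zero    r ()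
  parentOfVertex≡vertex⇒same-star {i} {j} (suc _) r eq =
    proj₁ (Fin.combine-injective i zero j r (Fin.suc-injective eq))

  child⇒∈star : ∀ {u} j r → ChildOf u (vertex j r) → u ∈ star j
  child⇒∈star {u} j r (_ , parent-u≡v) with view u
  ... | is-root        = ⊥-elim (Fin.0≢1+n parent-u≡v)
  ... | is-vertex i r′ = subst (λ j → vertex i r′ ∈ star j)
                               (parentOfVertex≡vertex⇒same-star r′ r (trans (sym (parent-vertex i r′)) parent-u≡v))
                               (vertex∈star i r′)

  only-hubs-have-outside-parent : ∀ j r → parent (vertex j r) ∉ star j → r ≡ zero
  only-hubs-have-outside-parent j zero    _ = refl
  only-hubs-have-outside-parent j (suc r) p∉ =
    contradiction (subst (_∈ star j) (sym (parent-vertex j (suc r))) (vertex∈star j zero)) p∉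

  outside-neighbour : ∀ {u} j r → u ∈ N graph (vertex j r) ∩ ∁ (star j) → u ≡ root × r ≡ zero
  outside-neighbour {u} j r u∈ with u∈N , u∈∁S ← x∈p∩q⁻ (N graph (vertex j r)) (∁ (star j)) u∈
                               with ∈N⇒Linked u∈N
  ... | inj₂ u-child        = contradiction (child⇒∈star j r u-child) (x∈∁p⇒x∉p u∈∁S)
  ... | inj₁ (_ , parent≡u) =
    trans (sym parent≡u) (trans (parent-vertex j r) (cong (parentOfVertex j) r≡0)) , r≡0
    where
    r≡0 = only-hubs-have-outside-parent j r (subst (_∉ star j) (sym parent≡u) (x∈∁p⇒x∉p u∈∁S))

  hubNeighbour : Fin k → Fin (suc l) → V
  hubNeighbour j zero    = root
  hubNeighbour j (suc r) = vertex j (suc r)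

  hubNeighbour-injective : ∀ j → Injective _≡_ _≡_ (hubNeighbour j)
  hubNeighbour-injective j {zero}  {zero}   _  = refl
  hubNeighbour-injective j {zero}  {suc _}  eq = ⊥-elim (Fin.0≢1+n eq)
  hubNeighbour-injective j {suc _} {zero}   eq = ⊥-elim (Fin.0≢1+n (sym eq))
  hubNeighbour-injective j {suc r} {suc r′} eq =
    proj₂ (Fin.combine-injective j (suc r) j (suc r′) (Fin.suc-injective eq))

  hubNeighbour∈N : ∀ j r → hubNeighbour j r ∈ N graph (hub j)
  hubNeighbour∈N j zero    = Linked⇒∈N (inj₁ (vertex-childOf-parent j zero))
  hubNeighbour∈N j (suc r) = Linked⇒∈N (inj₂ (vertex-childOf-parent j (suc r)))

  1+l≤deg-hub : ∀ j → suc l ℕ.≤ deg graph (hub j)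
  1+l≤deg-hub j = injective⇒≤∣p∣ (hubNeighbour j) (hubNeighbour-injective j) (hubNeighbour∈N j)

  1≤deg-vertex : ∀ j r → 1 ℕ.≤ deg graph (vertex j r)
  1≤deg-vertex j r = ℕ.≤-trans (s≤s z≤n) (x∈p⇒∣p-x∣<∣p∣ (Linked⇒∈N (inj₁ (vertex-childOf-parent j r))))

  hub-outside≤1 : ∀ j → ∣ N graph (hub j) ∩ ∁ (star j) ∣ ℕ.≤ 1
  hub-outside≤1 j = subst (∣ N graph (hub j) ∩ ∁ (star j) ∣ ℕ.≤_) (∣⁅x⁆∣≡1 root) (p⊆q⇒∣p∣≤∣q∣ ⊆⁅root⁆)
    where
    ⊆⁅root⁆ : N graph (hub j) ∩ ∁ (star j) ⊆ ⁅ root ⁆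
    ⊆⁅root⁆ = Equivalence.from x∈⁅y⁆⇔x≡y ∘ proj₁ ∘ outside-neighbour j zero

  leaf-outside≡0 : ∀ j r → ∣ N graph (vertex j (suc r)) ∩ ∁ (star j) ∣ ≡ 0
  leaf-outside≡0 j r =
    trans (cong ∣_∣ (Empty-unique λ (u , u∈) → Fin.0≢1+n (sym (proj₂ (outside-neighbour j (suc r) u∈)))))
          (∣⊥∣≡0 (suc (k ℕ.* suc l)))

  few-outside-neighbours : ∀ j v → v ∈ star j → ∣ N graph v ∩ ∁ (star j) ∣ ℕ.* l ℕ.< deg graph v
  few-outside-neighbours j v v∈ with ∈star⇒vertex v v∈
  ... | zero , refl = begin-strict
    ∣ N graph (hub j) ∩ ∁ (star j) ∣ ℕ.* l  ≤⟨ ℕ.*-monoˡ-≤ l (hub-outside≤1 j) ⟩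
    1 ℕ.* l                                 ≡⟨ ℕ.*-identityˡ l ⟩
    l                                       <⟨ ℕ.n<1+n l ⟩
    suc l                                   ≤⟨ 1+l≤deg-hub j ⟩
    deg graph (hub j)                       ∎
    where open ℕ.≤-Reasoning
  ... | suc r , refl =
    subst (λ c → c ℕ.* l ℕ.< deg graph (vertex j (suc r))) (sym (leaf-outside≡0 j r)) (1≤deg-vertex j (suc r))

module _ (k e : ℕ) where
  open DepthTwoTree k (suc e)

  star-resistant : ∀ j → Resistant graph 1/[1+ e ] (star j)
  star-resistant j v v∈ =
    ℕ→ℚ<1/[1+e]*ℕ→ℚ e {∣ N graph v ∩ ∁ (star j) ∣} {deg graph v} (few-outside-neighbours j v v∈)

  contagious⇒k≤∣A∣ : ∀ A → Contagious graph 1/[1+ e ] A → k ℕ.≤ ∣ A ∣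
  contagious⇒k≤∣A∣ A contagious = disjoint-meets⇒≤∣p∣ star ∈star-unique
    (λ j → contagious⇒meets-resistant graph 1/[1+ e ] contagious (star-resistant j) (vertex∈star j zero))

1/[1+denominator-1]≤ : ∀ {p} → 0ℚ < p → 1/[1+ ℚ.denominator-1 p ] ≤ p
1/[1+denominator-1]≤ {mkℚ (+ suc a) b _} _ =
  ℚ.toℚᵘ-cancel-≤ (/-≤-cross (ℕ.*-monoˡ-≤ (suc b) {1} {suc a} (s≤s z≤n)))
1/[1+denominator-1]≤ {mkℚ (+ 0) _ _}     (ℚ.*<* (ℤ.+<+ ()))
1/[1+denominator-1]≤ {mkℚ -[1+ _ ] _ _}  (ℚ.*<* ())

1/[1+]-antimono-< : ∀ {d e} → d ℕ.< e → 1/[1+ e ] < 1/[1+ d ]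
1/[1+]-antimono-< {d} {e} d<e = ℚ.toℚᵘ-cancel-< (/-<-cross (ℕ.*-monoʳ-< 1 (s≤s d<e)))

1-1/[1+b]≡b/[1+b] : ∀ b → 1ᵘ -ᵘ (+ 1 / suc b) ≡ + b / suc b
1-1/[1+b]≡b/[1+b] b rewrite ℕ.+-identityʳ b = refl

1-ε≤b/[1+b] : ∀ {ε} b → 1/[1+ b ] ≤ ε → toℚᵘ (1ℚ - ε) ≤ᵘ + b / suc b
1-ε≤b/[1+b] {ε} b ε≥ = begin
  toℚᵘ (1ℚ - ε)              ≃⟨ ℚ.toℚᵘ-homo-+ 1ℚ (ℚ.- ε) ⟩
  1ᵘ ℚᵘ.+ toℚᵘ (ℚ.- ε)        ≃⟨ ℚᵘ.+-congʳ 1ᵘ (ℚ.toℚᵘ-homo‿- ε) ⟩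
  1ᵘ -ᵘ toℚᵘ ε               ≤⟨ ℚᵘ.+-monoʳ-≤ 1ᵘ (ℚᵘ.neg-mono-≤ (ℚ.toℚᵘ-mono-≤ ε≥)) ⟩
  1ᵘ -ᵘ (+ 1 / suc b)        ≡⟨ 1-1/[1+b]≡b/[1+b] b ⟩
  + b / suc b                ∎
  where open ℚᵘ.≤-Reasoning

b[1+k[2+e]]<k[1+b][1+e] : ∀ {b e k} → b ℕ.< k → b ℕ.≤ e →
                          b ℕ.* suc (k ℕ.* suc (suc e)) ℕ.< k ℕ.* (suc b ℕ.* suc e)
b[1+k[2+e]]<k[1+b][1+e] {b} {e} {k} b<k b≤e = ℕ.+-cancelʳ-< (k ℕ.+ e ℕ.* k) _ _ (begin-strict
  b ℕ.* suc (k ℕ.* suc (suc e)) ℕ.+ (k ℕ.+ e ℕ.* k)  ≡⟨ expand b e k ⟩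
  k ℕ.* (suc b ℕ.* suc e) ℕ.+ (b ℕ.+ b ℕ.* k)        <⟨ ℕ.+-monoʳ-< (k ℕ.* (suc b ℕ.* suc e))
                                                          (ℕ.+-mono-<-≤ b<k (ℕ.*-monoˡ-≤ k b≤e)) ⟩
  k ℕ.* (suc b ℕ.* suc e) ℕ.+ (k ℕ.+ e ℕ.* k)        ∎)
  where
  open ℕ.≤-Reasoning
  expand : ∀ b e k → b ℕ.* suc (k ℕ.* suc (suc e)) ℕ.+ (k ℕ.+ e ℕ.* k)
                   ≡ k ℕ.* (suc b ℕ.* suc e) ℕ.+ (b ℕ.+ b ℕ.* k)
  expand = solve-∀

[1-ε]ρn<k : ∀ {ε b e k} → 1/[1+ b ] ≤ ε → b ℕ.< k → b ℕ.≤ e →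
            (1ℚ - ε) * 1/[1+ e ] * ℕ→ℚ (suc (k ℕ.* suc (suc e))) < ℕ→ℚ k
[1-ε]ρn<k {ε} {b} {e} {k} ε≥ b<k b≤e = ℚ.toℚᵘ-cancel-< (begin-strict
  toℚᵘ ((1ℚ - ε) * 1/[1+ e ] * ℕ→ℚ n)             ≃⟨ ℚ.toℚᵘ-homo-* ((1ℚ - ε) * 1/[1+ e ]) (ℕ→ℚ n) ⟩
  toℚᵘ ((1ℚ - ε) * 1/[1+ e ]) *ᵘ toℚᵘ (ℕ→ℚ n)     ≃⟨ ℚᵘ.*-congʳ (ℚ.toℚᵘ-homo-* (1ℚ - ε) 1/[1+ e ]) ⟩
  toℚᵘ (1ℚ - ε) *ᵘ (+ 1 / suc e) *ᵘ toℚᵘ (ℕ→ℚ n)  ≡⟨ cong (toℚᵘ (1ℚ - ε) *ᵘ (+ 1 / suc e) *ᵘ_) (toℚᵘ-ℕ→ℚ n) ⟩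
  toℚᵘ (1ℚ - ε) *ᵘ (+ 1 / suc e) *ᵘ (+ n / 1)     ≤⟨ ℚᵘ.*-monoˡ-≤-nonNeg (+ n / 1)
                                                       (ℚᵘ.*-monoˡ-≤-nonNeg (+ 1 / suc e) (1-ε≤b/[1+b] b ε≥)) ⟩
  (+ b / suc b) *ᵘ (+ 1 / suc e) *ᵘ (+ n / 1)     ≡⟨ cong (_*ᵘ (+ n / 1)) (/-*-/ b b 1 e) ⟩
  (+ (b ℕ.* 1) / (suc b ℕ.* suc e)) *ᵘ (+ n / 1)  ≡⟨ /-*-/ (b ℕ.* 1) (e ℕ.+ b ℕ.* suc e) n 0 ⟩
  + (b ℕ.* 1 ℕ.* n) / (suc b ℕ.* suc e ℕ.* 1)      <⟨ /-<-cross cross ⟩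
  + k / 1                                          ≡⟨ toℚᵘ-ℕ→ℚ k ⟨
  toℚᵘ (ℕ→ℚ k)                                     ∎)
  where
  open ℚᵘ.≤-Reasoning
  n = suc (k ℕ.* suc (suc e))
  cross : b ℕ.* 1 ℕ.* n ℕ.* 1 ℕ.< k ℕ.* (suc b ℕ.* suc e ℕ.* 1)
  cross = subst₂ ℕ._<_ (sym (trans (ℕ.*-identityʳ _) (cong (ℕ._* n) (ℕ.*-identityʳ b))))
                       (cong (k ℕ.*_) (sym (ℕ.*-identityʳ _)))
                       (b[1+k[2+e]]<k[1+b][1+e] b<k b≤e)

mainTheorem3 : (ε ρ₀ : ℚ) (N₀ : ℕ) → 0ℚ < ε → 0ℚ < ρ₀ →
    Σ ℚ λ ρ → (0ℚ < ρ × ρ < ρ₀) × Σ ℕ λ n → n > N₀ × Σ (Graph n) λ G →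
      Connected G × GirthAtLeast5 G ×
      (∀ (A : Subset n) → Contagious G ρ A → (1ℚ - ε) * ρ * ℕ→ℚ n < ℕ→ℚ ∣ A ∣)
mainTheorem3 ε ρ₀ N₀ 0<ε 0<ρ₀ =
  1/[1+ e ] , (ℚ.positive⁻¹ 1/[1+ e ] , ρ<ρ₀) ,
  suc (k ℕ.* suc (suc e)) , n>N₀ ,
  graph , connected root descends , girth≥5 ,
  λ A contagious → ℚ.<-≤-trans ([1-ε]ρn<k (1/[1+denominator-1]≤ 0<ε) b<k b≤e)
                               (ℕ→ℚ-mono-≤ (contagious⇒k≤∣A∣ k e A contagious))
  where
  b = ℚ.denominator-1 ε
  d = ℚ.denominator-1 ρ₀
  e = suc (d ℕ.+ b)
  k = suc (N₀ ℕ.+ b)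
  open DepthTwoTree k (suc e)
  ρ<ρ₀ : 1/[1+ e ] < ρ₀
  ρ<ρ₀ = ℚ.<-≤-trans (1/[1+]-antimono-< (s≤s (ℕ.m≤m+n d b))) (1/[1+denominator-1]≤ 0<ρ₀)
  b<k : b ℕ.< k
  b<k = s≤s (ℕ.m≤n+m b N₀)
  b≤e : b ℕ.≤ e
  b≤e = ℕ.≤-trans (ℕ.m≤n+m b d) (ℕ.n≤1+n _)
  n>N₀ : suc (k ℕ.* suc (suc e)) > N₀
  n>N₀ = s≤s (ℕ.≤-trans (ℕ.≤-trans (ℕ.m≤m+n N₀ b) (ℕ.n≤1+n _)) (ℕ.m≤m*n k (suc (suc e))))
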